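{- For integers $n\ge 0$ and $p\ge 0$ with $n+1\ge p$, $$\sum_{j,k}\genfrac{[}{]}{0pt}{}{n}{k}\binom{k}{j}\genfrac{\{}{\}}{0pt}{}{j+1}{p}(-1)^j=\begin{cases}0, & n+1>p,\\ (-1)^n, & n+1=p.\end{cases}$$
   Context: Here $\genfrac{[}{]}{0pt}{}{n}{k}$ denotes the unsigned (absolute) Stirling number of the first kind and $\genfrac{\{}{\}}{0pt}{}{n}{k}$ the ordinary Stirling number of the second kind (Knuth's notation), with $\genfrac{[}{]}{0pt}{}{0}{0}=\genfrac{\{}{\}}{0pt}{}{0}{0}=1$, $\genfrac{[}{]}{0pt}{}{n}{0}=\genfrac{\{}{\}}{0pt}{}{n}{0}=0$ for $n>0$, and both vanish for $0\le n<k$. The double summation is over all integers $j,k$ with $0\le j\le k\le n$. -}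

module Defs where

open import Data.Nat using (ℕ; zero; suc)
import Data.Nat as ℕ
open import Data.Nat.Combinatorics using (_C_)
open import Data.Integer using (ℤ; +_; _+_; _*_; -_)

stirling1 : ℕ → ℕ → ℕ
stirling1 zero    zero    = 1
stirling1 zero    (suc k) = 0
stirling1 (suc n) zero    = 0
stirling1 (suc n) (suc k) = n ℕ.* stirling1 n (suc k) ℕ.+ stirling1 n k

stirling2 : ℕ → ℕ → ℕ
stirling2 zero    zero    = 1
stirling2 zero    (suc k) = 0
stirling2 (suc n) zero    = 0
stirling2 (suc n) (suc k) = suc k ℕ.* stirling2 n (suc k) ℕ.+ stirling2 n k

sign : ℕ → ℤ
sign zero    = + 1
sign (suc j) = - sign j

sumTo : ℕ → (ℕ → ℤ) → ℤ
sumTo zero    f = f 0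
sumTo (suc m) f = sumTo m f + f (suc m)

doubleSum : ℕ → ℕ → ℤ
doubleSum n p =
  sumTo n (λ k → sumTo k (λ j →
    (+ (stirling1 n k ℕ.* (k C j) ℕ.* stirling2 (suc j) p)) * sign j))

--  1. Inner sum (a binomial transform of Stirling numbers of the second kind).
--     For fixed k put  B k p = Σ_{j ≤ k} C(k,j) (-1)^j {j+1 p}.
--     Then B k 0 = 0 and B k (q+1) = (-1)^k {k q}.  This follows by induction
--     on k: Pascal's rule splits B (k+1) into B k plus an index-shifted sum,
--     and the recurrence {i+1 r+1} = (r+1){i r+1} + {i r} rewrites the shifted
--     sum, giving B (k+1) (q+1) = -q B k (q+1) - B k q.
--
--  2. Outer sum (orthogonality of the two kinds of Stirling numbers).
--     With  F n q = Σ_{k ≤ n} [n k] (-1)^k {k q}  we have F n q = (-1)^n δ(n,q).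
--     Again by induction on n: the recurrence [n+1 k+1] = n [n k+1] + [n k]
--     and the same recurrence for {· ·} give F (n+1) (q+1) = n F n (q+1)
--     - (q+1) F n (q+1) - F n q, and n δ(n,m) = m δ(n,m).
--
-- The double sum equals Σ_k [n k] B k p, hence it is 0 for p = 0 and
-- F n q = (-1)^n δ(n,q) for p = q+1, which is the theorem.
module Submission where

open import Defs
open import Data.Nat using (ℕ; zero; suc; _≤_; _<_; s≤s)
import Data.Nat as ℕ
import Data.Nat.Properties as ℕ
open import Data.Nat.Combinatorics using (_C_; nCk+nC[k+1]≡[n+1]C[k+1]; k>n⇒nCk≡0)
open import Data.Integer using (ℤ; +_; _+_; _*_; -_; _-_)
open import Data.Integer.Properties using (pos-*; pos-+; *-zeroʳ; *-identityʳ; *-distribˡ-+; *-distribʳ-+; *-assoc; *-identityˡ; +-identityˡ; +-identityʳ)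
open import Data.Integer.Solver using (module +-*-Solver)
open import Data.Product using (_×_; _,_)
open import Relation.Binary.PropositionalEquality using (_≡_; refl; sym; trans; cong; cong₂; module ≡-Reasoning)
open ≡-Reasoning
open +-*-Solver using (solve; _:+_; _:-_; _:*_; :-_; con; _:=_)

S₂ : ℕ → ℕ → ℤ
S₂ i q = + stirling2 i q

sumTo-cong : ∀ m {f g : ℕ → ℤ} → (∀ i → f i ≡ g i) → sumTo m f ≡ sumTo m g
sumTo-cong zero    eq = eq 0
sumTo-cong (suc m) eq = cong₂ _+_ (sumTo-cong m eq) (eq (suc m))

sumTo-zero : ∀ m {f : ℕ → ℤ} → (∀ i → f i ≡ + 0) → sumTo m f ≡ + 0
sumTo-zero zero    eq = eq 0
sumTo-zero (suc m) eq = cong₂ _+_ (sumTo-zero m eq) (eq (suc m))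

sumTo-+ : ∀ m (f g : ℕ → ℤ) → sumTo m (λ i → f i + g i) ≡ sumTo m f + sumTo m g
sumTo-+ zero    f g = refl
sumTo-+ (suc m) f g =
  trans (cong (_+ (f (suc m) + g (suc m))) (sumTo-+ m f g))
        (solve 4 (λ a b c d → (a :+ b) :+ (c :+ d) := (a :+ c) :+ (b :+ d))
               refl (sumTo m f) (sumTo m g) (f (suc m)) (g (suc m)))

sumTo-*ˡ : ∀ m c (f : ℕ → ℤ) → sumTo m (λ i → c * f i) ≡ c * sumTo m f
sumTo-*ˡ zero    c f = refl
sumTo-*ˡ (suc m) c f =
  trans (cong (_+ c * f (suc m)) (sumTo-*ˡ m c f)) (sym (*-distribˡ-+ c _ _))

sumTo-linear : ∀ m a (f g : ℕ → ℤ) →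
  sumTo m (λ i → - a * f i - g i) ≡ - a * sumTo m f - sumTo m g
sumTo-linear m a f g = begin
    sumTo m (λ i → - a * f i - g i)
  ≡⟨ sumTo-cong m (λ i → solve 3 (λ a x y → :- a :* x :- y := :- a :* x :+ (:- con (+ 1)) :* y)
                                  refl a (f i) (g i)) ⟩
    sumTo m (λ i → - a * f i + - + 1 * g i)
  ≡⟨ sumTo-+ m _ _ ⟩
    sumTo m (λ i → - a * f i) + sumTo m (λ i → - + 1 * g i)
  ≡⟨ cong₂ _+_ (sumTo-*ˡ m (- a) f) (sumTo-*ˡ m (- + 1) g) ⟩
    - a * sumTo m f + - + 1 * sumTo m g
  ≡⟨ solve 3 (λ a x y → :- a :* x :+ (:- con (+ 1)) :* y := :- a :* x :- y) refl a (sumTo m f) (sumTo m g) ⟩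
    - a * sumTo m f - sumTo m g
  ∎

sumTo-peel : ∀ m (f : ℕ → ℤ) → sumTo (suc m) f ≡ f 0 + sumTo m (λ i → f (suc i))
sumTo-peel zero    f = refl
sumTo-peel (suc m) f =
  trans (cong (_+ f (suc (suc m))) (sumTo-peel m f))
        (solve 3 (λ a b c → (a :+ b) :+ c := a :+ (b :+ c)) refl (f 0) (sumTo m (λ i → f (suc i))) (f (suc (suc m))))

sumTo-dropLast : ∀ m (f : ℕ → ℤ) → f (suc m) ≡ + 0 → sumTo (suc m) f ≡ sumTo m f
sumTo-dropLast m f last = trans (cong (λ x → sumTo m f + x) last) (+-identityʳ (sumTo m f))

pascal-sum : ∀ k (t : ℕ → ℤ) →
  sumTo (suc k) (λ j → + (suc k C j) * t j)
    ≡ sumTo k (λ j → + (k C j) * t j) + sumTo k (λ j → + (k C j) * t (suc j))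
pascal-sum k t = begin
    sumTo (suc k) (λ j → + (suc k C j) * t j)
  ≡⟨ sumTo-peel k _ ⟩
    t₀ + sumTo k (λ j → + (suc k C suc j) * t (suc j))
  ≡⟨ cong (λ x → t₀ + x) (trans (sumTo-cong k pascal) (sumTo-+ k _ _)) ⟩
    t₀ + (shifted + sumTo k (λ j → + (k C suc j) * t (suc j)))
  ≡⟨ solve 3 (λ a b c → a :+ (b :+ c) := (a :+ c) :+ b) refl t₀ shifted _ ⟩
    (t₀ + sumTo k (λ j → + (k C suc j) * t (suc j))) + shifted
  ≡⟨ cong (_+ shifted) (sym (sumTo-peel k _)) ⟩
    sumTo (suc k) (λ j → + (k C j) * t j) + shifted
  ≡⟨ cong (_+ shifted) (sumTo-dropLast k _ (cong (λ c → + c * t (suc k)) (k>n⇒nCk≡0 (ℕ.n<1+n k)))) ⟩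
    sumTo k (λ j → + (k C j) * t j) + shifted
  ∎
  where
  t₀ : ℤ
  t₀ = + 1 * t 0
  shifted : ℤ
  shifted = sumTo k (λ j → + (k C j) * t (suc j))
  pascal : ∀ j → + (suc k C suc j) * t (suc j) ≡ + (k C j) * t (suc j) + + (k C suc j) * t (suc j)
  pascal j = begin
      + (suc k C suc j) * t (suc j)
    ≡⟨ cong (λ c → + c * t (suc j)) (sym (nCk+nC[k+1]≡[n+1]C[k+1] k j)) ⟩
      + (k C j ℕ.+ k C suc j) * t (suc j)
    ≡⟨ cong (_* t (suc j)) (pos-+ (k C j) (k C suc j)) ⟩
      (+ (k C j) + + (k C suc j)) * t (suc j)
    ≡⟨ *-distribʳ-+ (t (suc j)) (+ (k C j)) (+ (k C suc j)) ⟩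
      + (k C j) * t (suc j) + + (k C suc j) * t (suc j)
    ∎

stirling1-vanish : ∀ n k → n < k → stirling1 n k ≡ 0
stirling1-vanish zero    (suc k) _        = refl
stirling1-vanish (suc n) (suc k) (s≤s n<k) =
  cong₂ ℕ._+_ (trans (cong (n ℕ.*_) (stirling1-vanish n (suc k) (ℕ.m<n⇒m<1+n n<k))) (ℕ.*-zeroʳ n))
              (stirling1-vanish n k n<k)

n*stirling1-n-0 : ∀ n → n ℕ.* stirling1 n 0 ≡ 0
n*stirling1-n-0 zero    = refl
n*stirling1-n-0 (suc n) = ℕ.*-zeroʳ (suc n)

stirling1-sum : ∀ n (t : ℕ → ℤ) →
  sumTo (suc n) (λ k → + stirling1 (suc n) k * t k)
    ≡ + n * sumTo n (λ k → + stirling1 n k * t k) + sumTo n (λ k → + stirling1 n k * t (suc k))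
stirling1-sum n t = begin
    sumTo (suc n) (λ k → + stirling1 (suc n) k * t k)
  ≡⟨ sumTo-peel n _ ⟩
    + 0 + sumTo n (λ k → + stirling1 (suc n) (suc k) * t (suc k))
  ≡⟨ trans (+-identityˡ _) (trans (sumTo-cong n recurrence) (sumTo-+ n _ _)) ⟩
    sumTo n (λ k → + n * (+ stirling1 n (suc k) * t (suc k))) + shifted
  ≡⟨ cong (_+ shifted) (trans (sumTo-*ˡ n (+ n) _) unshift) ⟩
    + n * sumTo n (λ k → + stirling1 n k * t k) + shifted
  ∎
  where
  shifted : ℤ
  shifted = sumTo n (λ k → + stirling1 n k * t (suc k))
  recurrence : ∀ k → + stirling1 (suc n) (suc k) * t (suc k)
                     ≡ + n * (+ stirling1 n (suc k) * t (suc k)) + + stirling1 n k * t (suc k)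
  recurrence k = begin
      + (n ℕ.* stirling1 n (suc k) ℕ.+ stirling1 n k) * t (suc k)
    ≡⟨ cong (_* t (suc k)) (trans (pos-+ (n ℕ.* stirling1 n (suc k)) (stirling1 n k)) (cong (_+ + stirling1 n k) (pos-* n (stirling1 n (suc k))))) ⟩
      (+ n * + stirling1 n (suc k) + + stirling1 n k) * t (suc k)
    ≡⟨ solve 4 (λ a b c x → (a :* b :+ c) :* x := a :* (b :* x) :+ c :* x)
         refl (+ n) (+ stirling1 n (suc k)) (+ stirling1 n k) (t (suc k)) ⟩
      + n * (+ stirling1 n (suc k) * t (suc k)) + + stirling1 n k * t (suc k)
    ∎
  -- Reindexing Σ_{k ≤ n} [n k] t k from 1 is harmless: [n n+1] = 0 and n [n 0] = 0.
  unshift : + n * sumTo n (λ k → + stirling1 n (suc k) * t (suc k))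
            ≡ + n * sumTo n (λ k → + stirling1 n k * t k)
  unshift = begin
      + n * sumTo n (λ k → + stirling1 n (suc k) * t (suc k))
    ≡⟨ sym (trans (cong (_+ + n * rest) firstVanishes) (+-identityˡ (+ n * rest))) ⟩
      + n * (+ stirling1 n 0 * t 0) + + n * sumTo n (λ k → + stirling1 n (suc k) * t (suc k))
    ≡⟨ sym (*-distribˡ-+ (+ n) _ _) ⟩
      + n * (+ stirling1 n 0 * t 0 + sumTo n (λ k → + stirling1 n (suc k) * t (suc k)))
    ≡⟨ cong (+ n *_) (sym (sumTo-peel n _)) ⟩
      + n * sumTo (suc n) (λ k → + stirling1 n k * t k)
    ≡⟨ cong (+ n *_) (sumTo-dropLast n _ (cong (λ s → + s * t (suc n)) (stirling1-vanish n (suc n) (ℕ.n<1+n n)))) ⟩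
      + n * sumTo n (λ k → + stirling1 n k * t k)
    ∎
    where
    rest : ℤ
    rest = sumTo n (λ k → + stirling1 n (suc k) * t (suc k))
    firstVanishes : + n * (+ stirling1 n 0 * t 0) ≡ + 0
    firstVanishes = trans (sym (*-assoc (+ n) _ (t 0)))
                          (cong (_* t 0) (trans (sym (pos-* n _)) (cong +_ (n*stirling1-n-0 n))))

negated-stirling2-step : ∀ σ i r → - σ * S₂ (suc i) (suc r) ≡ - + suc r * (σ * S₂ i (suc r)) - σ * S₂ i r
negated-stirling2-step σ i r = begin
    - σ * S₂ (suc i) (suc r)
  ≡⟨ cong (- σ *_) (trans (pos-+ (suc r ℕ.* stirling2 i (suc r)) (stirling2 i r))
                          (cong (_+ S₂ i r) (pos-* (suc r) (stirling2 i (suc r))))) ⟩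
    - σ * (+ suc r * S₂ i (suc r) + S₂ i r)
  ≡⟨ solve 4 (λ σ c x y → :- σ :* (c :* x :+ y) := :- c :* (σ :* x) :- σ :* y) refl σ (+ suc r) (S₂ i (suc r)) (S₂ i r) ⟩
    - + suc r * (σ * S₂ i (suc r)) - σ * S₂ i r
  ∎

-- The same recurrence summed against weights c, with sign (-1)^j and row index e j.
-- (Used with e j = j + 1 for the inner sum and e j = j for the outer sum.)
stirling2-sum : ∀ m (c : ℕ → ℤ) (e : ℕ → ℕ) r →
  sumTo m (λ j → c j * (sign (suc j) * S₂ (suc (e j)) (suc r)))
    ≡ - + suc r * sumTo m (λ j → c j * (sign j * S₂ (e j) (suc r))) - sumTo m (λ j → c j * (sign j * S₂ (e j) r))
stirling2-sum m c e r = begin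
    sumTo m (λ j → c j * (- sign j * S₂ (suc (e j)) (suc r)))
  ≡⟨ sumTo-cong m (λ j → cong (c j *_) (negated-stirling2-step (sign j) (e j) r)) ⟩
    sumTo m (λ j → c j * (- + suc r * x j - y j))
  ≡⟨ sumTo-cong m (λ j → solve 4 (λ c a x y → c :* (:- a :* x :- y) := :- a :* (c :* x) :- c :* y)
                                  refl (c j) (+ suc r) (x j) (y j)) ⟩
    sumTo m (λ j → - + suc r * (c j * x j) - c j * y j)
  ≡⟨ sumTo-linear m (+ suc r) _ _ ⟩
    - + suc r * sumTo m (λ j → c j * x j) - sumTo m (λ j → c j * y j)
  ∎
  where
  x y : ℕ → ℤ
  x j = sign j * S₂ (e j) (suc r)
  y j = sign j * S₂ (e j) r

binomialSum : ℕ → ℕ → ℤ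
binomialSum k p = sumTo k (λ j → + (k C j) * (sign j * S₂ (suc j) p))

binomialSum-zero : ∀ k → binomialSum k 0 ≡ + 0
binomialSum-zero k = sumTo-zero k (λ j → trans (cong (+ (k C j) *_) (*-zeroʳ (sign j))) (*-zeroʳ (+ (k C j))))

binomialSum-step : ∀ k q → binomialSum (suc k) (suc q) ≡ - + q * binomialSum k (suc q) - binomialSum k q
binomialSum-step k q = begin
    binomialSum (suc k) (suc q)
  ≡⟨ pascal-sum k (λ j → sign j * S₂ (suc j) (suc q)) ⟩
    binomialSum k (suc q) + sumTo k (λ j → + (k C j) * (sign (suc j) * S₂ (suc (suc j)) (suc q)))
  ≡⟨ cong (λ s → binomialSum k (suc q) + s) (stirling2-sum k (λ j → + (k C j)) suc q) ⟩
    binomialSum k (suc q) + (- (+ 1 + + q) * binomialSum k (suc q) - binomialSum k q)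
  ≡⟨ solve 3 (λ b q c → b :+ (:- (con (+ 1) :+ q) :* b :- c) := :- q :* b :- c)
       refl (binomialSum k (suc q)) (+ q) (binomialSum k q) ⟩
    - + q * binomialSum k (suc q) - binomialSum k q
  ∎

binomialSum-closed : ∀ k q → binomialSum k (suc q) ≡ sign k * S₂ k q
binomialSum-closed zero q =
  trans (cong (λ x → + 1 * (+ 1 * + (x ℕ.+ stirling2 0 q))) (ℕ.*-zeroʳ (suc q)))
        (cong (+ 1 *_) (*-identityˡ (S₂ 0 q)))
binomialSum-closed (suc k) zero = begin
    binomialSum (suc k) 1
  ≡⟨ binomialSum-step k 0 ⟩
    - + 0 * binomialSum k 1 - binomialSum k 0
  ≡⟨ cong (λ b → - + 0 * binomialSum k 1 - b) (binomialSum-zero k) ⟩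
    + 0
  ≡⟨ sym (*-zeroʳ (sign (suc k))) ⟩
    sign (suc k) * S₂ (suc k) 0
  ∎
binomialSum-closed (suc k) (suc r) = begin
    binomialSum (suc k) (suc (suc r))
  ≡⟨ binomialSum-step k (suc r) ⟩
    - + suc r * binomialSum k (suc (suc r)) - binomialSum k (suc r)
  ≡⟨ cong₂ (λ a b → - + suc r * a - b) (binomialSum-closed k (suc r)) (binomialSum-closed k r) ⟩
    - + suc r * (sign k * S₂ k (suc r)) - sign k * S₂ k r
  ≡⟨ sym (negated-stirling2-step (sign k) k r) ⟩
    sign (suc k) * S₂ (suc k) (suc r)
  ∎

stirlingPairing : ℕ → ℕ → ℤ
stirlingPairing n q = sumTo n (λ k → + stirling1 n k * (sign k * S₂ k q))

stirlingPairing-step-zero : ∀ n → stirlingPairing (suc n) 0 ≡ + n * stirlingPairing n 0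
stirlingPairing-step-zero n = begin
    stirlingPairing (suc n) 0
  ≡⟨ stirling1-sum n (λ k → sign k * S₂ k 0) ⟩
    + n * stirlingPairing n 0 + sumTo n (λ k → + stirling1 n k * (sign (suc k) * S₂ (suc k) 0))
  ≡⟨ cong (λ s → + n * stirlingPairing n 0 + s) (sumTo-zero n vanishing) ⟩
    + n * stirlingPairing n 0 + + 0
  ≡⟨ +-identityʳ _ ⟩
    + n * stirlingPairing n 0
  ∎
  where
  vanishing : ∀ k → + stirling1 n k * (sign (suc k) * S₂ (suc k) 0) ≡ + 0
  vanishing k = trans (cong (+ stirling1 n k *_) (*-zeroʳ (sign (suc k)))) (*-zeroʳ (+ stirling1 n k))

stirlingPairing-step : ∀ n r → stirlingPairing (suc n) (suc r)
  ≡ + n * stirlingPairing n (suc r) + (- + suc r * stirlingPairing n (suc r) - stirlingPairing n r)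
stirlingPairing-step n r =
  trans (stirling1-sum n (λ k → sign k * S₂ k (suc r)))
        (cong (λ s → + n * stirlingPairing n (suc r) + s) (stirling2-sum n (λ k → + stirling1 n k) (λ k → k) r))

kronecker : ℕ → ℕ → ℤ
kronecker zero    zero    = + 1
kronecker zero    (suc m) = + 0
kronecker (suc n) zero    = + 0
kronecker (suc n) (suc m) = kronecker n m

-- δ(n,m) is supported on n = m, so n δ(n,m) = m δ(n,m).
kronecker-weight : ∀ n m → + n * kronecker n m ≡ + m * kronecker n m
kronecker-weight zero    zero    = refl
kronecker-weight zero    (suc m) = sym (*-zeroʳ (+ suc m))
kronecker-weight (suc n) zero    = *-zeroʳ (+ suc n)
kronecker-weight (suc n) (suc m) = begin
    (+ 1 + + n) * d
  ≡⟨ *-distribʳ-+ d (+ 1) (+ n) ⟩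
    + 1 * d + + n * d
  ≡⟨ cong (λ x → + 1 * d + x) (kronecker-weight n m) ⟩
    + 1 * d + + m * d
  ≡⟨ sym (*-distribʳ-+ d (+ 1) (+ m)) ⟩
    (+ 1 + + m) * d
  ∎
  where
  d : ℤ
  d = kronecker n m

kronecker-off : ∀ n q → q < n → kronecker n q ≡ + 0
kronecker-off (suc n) zero    _         = refl
kronecker-off (suc n) (suc q) (s≤s q<n) = kronecker-off n q q<n

kronecker-diag : ∀ n → kronecker n n ≡ + 1
kronecker-diag zero    = refl
kronecker-diag (suc n) = kronecker-diag n

stirlingPairing-closed : ∀ n q → stirlingPairing n q ≡ sign n * kronecker n q
stirlingPairing-closed zero    zero    = refl
stirlingPairing-closed zero    (suc q) = refl
stirlingPairing-closed (suc n) zero    = begin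
    stirlingPairing (suc n) 0
  ≡⟨ stirlingPairing-step-zero n ⟩
    + n * stirlingPairing n 0
  ≡⟨ cong (+ n *_) (stirlingPairing-closed n 0) ⟩
    + n * (sign n * kronecker n 0)
  ≡⟨ solve 3 (λ a s d → a :* (s :* d) := s :* (a :* d)) refl (+ n) (sign n) (kronecker n 0) ⟩
    sign n * (+ n * kronecker n 0)
  ≡⟨ cong (sign n *_) (kronecker-weight n 0) ⟩
    sign n * + 0
  ≡⟨ *-zeroʳ (sign n) ⟩
    + 0
  ≡⟨ sym (*-zeroʳ (sign (suc n))) ⟩
    sign (suc n) * kronecker (suc n) 0
  ∎
stirlingPairing-closed (suc n) (suc r) = begin
    stirlingPairing (suc n) (suc r)
  ≡⟨ stirlingPairing-step n r ⟩
    + n * stirlingPairing n (suc r) + (- + suc r * stirlingPairing n (suc r) - stirlingPairing n r)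
  ≡⟨ cong₂ (λ a b → + n * a + (- + suc r * a - b)) (stirlingPairing-closed n (suc r)) (stirlingPairing-closed n r) ⟩
    + n * (s * d₁) + (- + suc r * (s * d₁) - s * d₀)
  ≡⟨ solve 5 (λ a c s d₁ d₀ → a :* (s :* d₁) :+ (:- c :* (s :* d₁) :- s :* d₀) := s :* (a :* d₁ :- c :* d₁) :- s :* d₀)
       refl (+ n) (+ suc r) s d₁ d₀ ⟩
    s * (+ n * d₁ - + suc r * d₁) - s * d₀
  ≡⟨ cong (λ x → s * (x - + suc r * d₁) - s * d₀) (kronecker-weight n (suc r)) ⟩
    s * (+ suc r * d₁ - + suc r * d₁) - s * d₀
  ≡⟨ solve 3 (λ s x d₀ → s :* (x :- x) :- s :* d₀ := :- s :* d₀) refl s (+ suc r * d₁) d₀ ⟩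
    sign (suc n) * kronecker (suc n) (suc r)
  ∎
  where
  s d₁ d₀ : ℤ
  s  = sign n
  d₁ = kronecker n (suc r)
  d₀ = kronecker n r

regroup : ∀ a b c (s : ℤ) → + (a ℕ.* b ℕ.* c) * s ≡ + a * (+ b * (s * + c))
regroup a b c s = begin
    + (a ℕ.* b ℕ.* c) * s
  ≡⟨ cong (_* s) (trans (pos-* (a ℕ.* b) c) (cong (_* + c) (pos-* a b))) ⟩
    + a * + b * + c * s
  ≡⟨ solve 4 (λ a b c s → a :* b :* c :* s := a :* (b :* (s :* c))) refl (+ a) (+ b) (+ c) s ⟩
    + a * (+ b * (s * + c))
  ∎

doubleSum-factor : ∀ n p → doubleSum n p ≡ sumTo n (λ k → + stirling1 n k * binomialSum k p)
doubleSum-factor n p = sumTo-cong n λ k →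
  trans (sumTo-cong k (λ j → regroup (stirling1 n k) (k C j) (stirling2 (suc j) p) (sign j)))
        (sumTo-*ˡ k (+ stirling1 n k) _)

doubleSum-zero : ∀ n → doubleSum n 0 ≡ + 0
doubleSum-zero n = trans (doubleSum-factor n 0) (sumTo-zero n λ k →
  trans (cong (+ stirling1 n k *_) (binomialSum-zero k)) (*-zeroʳ (+ stirling1 n k)))

doubleSum-suc : ∀ n q → doubleSum n (suc q) ≡ sign n * kronecker n q
doubleSum-suc n q = begin
    doubleSum n (suc q)
  ≡⟨ doubleSum-factor n (suc q) ⟩
    sumTo n (λ k → + stirling1 n k * binomialSum k (suc q))
  ≡⟨ sumTo-cong n (λ k → cong (+ stirling1 n k *_) (binomialSum-closed k q)) ⟩
    stirlingPairing n q
  ≡⟨ stirlingPairing-closed n q ⟩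
    sign n * kronecker n q
  ∎

mainTheorem5 : (n p : ℕ) → p ≤ suc n →
    ((p < suc n → doubleSum n p ≡ + 0) × (p ≡ suc n → doubleSum n p ≡ sign n))
mainTheorem5 n zero    _ = (λ _ → doubleSum-zero n) , λ ()
mainTheorem5 n (suc q) _ = below , diagonal
  where
  below : suc q < suc n → doubleSum n (suc q) ≡ + 0
  below (s≤s q<n) = begin
      doubleSum n (suc q)          ≡⟨ doubleSum-suc n q ⟩
      sign n * kronecker n q       ≡⟨ cong (sign n *_) (kronecker-off n q q<n) ⟩
      sign n * + 0                 ≡⟨ *-zeroʳ (sign n) ⟩
      + 0                          ∎
  diagonal : suc q ≡ suc n → doubleSum n (suc q) ≡ sign n
  diagonal refl = begin
      doubleSum n (suc n)          ≡⟨ doubleSum-suc n n ⟩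
      sign n * kronecker n n       ≡⟨ cong (sign n *_) (kronecker-diag n) ⟩
      sign n * + 1                 ≡⟨ *-identityʳ (sign n) ⟩
      sign n                       ∎
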